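{- Let $\mathcal{Z}=\{z_0,\dots,z_{15}\}$ be the set of 16 Wang tiles described in the context, and let $\Omega_\mathcal{Z}$ be its Wang shift. There exist a valid configuration $x\in\Omega_\mathcal{Z}$ and a deterministic finite automaton with output $\mathcal{A}$, with input alphabet $\Sigma^2=\left\{\left(\begin{smallmatrix}0\\0\end{smallmatrix}\right),\left(\begin{smallmatrix}0\\1\end{smallmatrix}\right),\left(\begin{smallmatrix}1\\0\end{smallmatrix}\right),\left(\begin{smallmatrix}1\\1\end{smallmatrix}\right)\right\}$ and outputs in $\{0,\dots,15\}$, such that for every ${\boldsymbol{n}}\in\mathbb{Z}^2$ the tile index at position ${\boldsymbol{n}}$ in $x$ is $x_{\boldsymbol{n}}=\mathcal{A}(\operatorname{rep}_\mathcal{F}({\boldsymbol{n}}))$, where $\operatorname{rep}_\mathcal{F}:\mathbb{Z}^2\to(\Sigma^2)^*$ is the Fibonacci representation function defined in the context.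
   Context: A Wang tile is a 4-tuple $(a,b,c,d)$ of colors, read as (east, north, west, south) edge labels of a unit square. The tiles are $z_0=(D,O,J,O)$, $z_1=(D,O,H,L)$, $z_2=(J,M,D,P)$, $z_3=(D,M,D,K)$, $z_4=(H,P,J,P)$, $z_5=(H,P,H,N)$, $z_6=(H,K,D,P)$, $z_7=(B,O,I,O)$, $z_8=(I,L,E,O)$, $z_9=(I,L,C,L)$, $z_{10}=(A,L,I,O)$, $z_{11}=(E,P,I,P)$, $z_{12}=(I,P,I,K)$, $z_{13}=(I,K,B,M)$, $z_{14}=(I,K,A,K)$, $z_{15}=(C,N,I,P)$ (colors are the letters $A,\dots,P$ as written). A valid configuration is a map $f:\mathbb{Z}^2\to\{0,\dots,15\}$ such that for every ${\boldsymbol{n}}\in\mathbb{Z}^2$ the east label of $z_{f({\boldsymbol{n}})}$ equals the west label of $z_{f({\boldsymbol{n}}+e_1)}$ and the north label of $z_{f({\boldsymbol{n}})}$ equals the south label of $z_{f({\boldsymbol{n}}+e_2)}$; $\Omega_\mathcal{Z}$ is the set of valid configurations. Fibonacci numbers: $F_0=1$, $F_1=1$, $F_{n+2}=F_{n+1}+F_n$ for $n\ge 0$. Let $\Sigma=\{0,1\}$. For an odd-length binary word $w=w_{2k+1}w_{2k}\cdots w_1$ (digits indexed from right to left), $\operatorname{val}_\mathcal{F}(w)=\sum_{i=1}^{2k}w_iF_i-w_{2k+1}F_{2k}$. For $n\in\mathbb{Z}$, $\operatorname{rep}_\mathcal{F}(n)$ is the unique odd-length word $w\in\Sigma(\Sigma\Sigma)^*$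 that contains no factor $11$, does not begin with $000$ and does not begin with $101$, and satisfies $\operatorname{val}_\mathcal{F}(w)=n$ (such a word exists and is unique). For ${\boldsymbol{n}}=(n_1,n_2)\in\mathbb{Z}^2$ let $t=\max\{|\operatorname{rep}_\mathcal{F}(n_1)|,|\operatorname{rep}_\mathcal{F}(n_2)|\}$ and for an odd-length word $w$ with $|w|\le t$ put $\operatorname{pad}_t(w)=(00)^{(t-|w|)/2}w$ if $w$ begins with $0$ and $\operatorname{pad}_t(w)=(10)^{(t-|w|)/2}w$ if $w$ begins with $1$. Then $\operatorname{rep}_\mathcal{F}({\boldsymbol{n}})$ is the word of length $t$ over the alphabet $\Sigma^2$ of column vectors whose top row is $\operatorname{pad}_t(\operatorname{rep}_\mathcal{F}(n_1))$ and whose bottom row is $\operatorname{pad}_t(\operatorname{rep}_\mathcal{F}(n_2))$. A deterministic finite automaton with output (DFAO) is a tuple $(Q,\Sigma',\delta,q_0,\tau)$ with a finite state set $Q$, input alphabet $\Sigma'$, (partial) transition function $\delta:Q\times\Sigma'\to Q$, initial state $q_0$ and output map $\tau$ on states; for a word $w$, $\mathcal{A}(w)=\tau(\delta(q_0,w))$, the output of the state reached from $q_0$ along the path labeled $w$ (which is required to exist). -}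

module Defs where

open import Data.Nat using (ℕ; zero; suc; _∸_; ⌊_/2⌋) renaming (_+_ to _+ℕ_; _⊔_ to _⊔ℕ_)
open import Data.Integer using (ℤ; +_; _-_; _+_)
open import Data.Bool using (Bool; true; false; if_then_else_)
open import Data.List using (List; []; _∷_; length; replicate; concat; _++_; zip)
open import Data.Maybe using (Maybe; just; nothing; _>>=_)
open import Data.Fin using (Fin)
open import Data.Vec using (Vec; lookup) renaming ([] to []v; _∷_ to _∷v_)
open import Data.Product using (_×_; _,_; Σ)
open import Relation.Binary.PropositionalEquality using (_≡_)
open import Relation.Nullary using (¬_)

data Color : Set where
  A B C D E F G H I J K L M N O P : Color

record Tile : Set where
  constructor tile
  field
    east north west south : Color
open Tile public

Z : Vec Tile 16
Z = tile D O J O ∷v tile D O H L ∷v tile J M D P ∷v tile D M D K ∷v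
    tile H P J P ∷v tile H P H N ∷v tile H K D P ∷v tile B O I O ∷v
    tile I L E O ∷v tile I L C L ∷v tile A L I O ∷v tile E P I P ∷v
    tile I P I K ∷v tile I K B M ∷v tile I K A K ∷v tile C N I P ∷v []v

z : Fin 16 → Tile
z i = lookup Z i

Configuration : Set
Configuration = ℤ × ℤ → Fin 16

Valid : Configuration → Set
Valid f = ∀ (n₁ n₂ : ℤ) →
  (east (z (f (n₁ , n₂))) ≡ west (z (f (n₁ + + 1 , n₂))))
  × (north (z (f (n₁ , n₂))) ≡ south (z (f (n₁ , n₂ + + 1))))

Fib : ℕ → ℕ
Fib zero = 1
Fib (suc zero) = 1
Fib (suc (suc n)) = Fib (suc n) +ℕ Fib n

-- Words are lists whose head is the leftmost (most significant) digit:
-- w = w_L w_{L-1} ... w_1 is the list w_L ∷ ... ∷ w_1 ∷ [].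
-- sumF w = Σ_{i=1}^{L} w_i F_i
sumF : List Bool → ℕ
sumF [] = 0
sumF (b ∷ w) = (if b then Fib (suc (length w)) else 0) +ℕ sumF w

valF : List Bool → ℤ
valF [] = + 0
valF (b ∷ w) = + sumF w - + (if b then Fib (length w) else 0)

data OddLength : List Bool → Set where
  one  : ∀ b → OddLength (b ∷ [])
  two  : ∀ a b w → OddLength w → OddLength (a ∷ b ∷ w)

data Has11 : List Bool → Set where
  here  : ∀ w → Has11 (true ∷ true ∷ w)
  there : ∀ b w → Has11 w → Has11 (b ∷ w)

data Begins : List Bool → List Bool → Set where
  begins : ∀ p w → Begins p (p ++ w)

-- w = rep_F(n): the characterising properties of the representation
IsRepF : List Bool → ℤ → Set
IsRepF w n =
  OddLength w × ¬ Has11 w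
  × ¬ Begins (false ∷ false ∷ false ∷ []) w
  × ¬ Begins (true ∷ false ∷ true ∷ []) w
  × valF w ≡ n

pad : ℕ → List Bool → List Bool
pad t [] = []
pad t (b ∷ w) =
  concat (replicate ⌊ (t ∸ suc (length w)) /2⌋ (b ∷ false ∷ [])) ++ (b ∷ w)

-- rep_F(n) for n ∈ ℤ² given rep_F(n₁) = u and rep_F(n₂) = v:
-- top row pad_t(u), bottom row pad_t(v)
pairRep : List Bool → List Bool → List (Bool × Bool)
pairRep u v = zip (pad t u) (pad t v)
  where t = length u ⊔ℕ length v

record DFAO : Set where
  field
    nStates : ℕ
    δ       : Fin nStates → Bool × Bool → Maybe (Fin nStates)
    q₀      : Fin nStates
    τ       : Fin nStates → Fin 16
open DFAO public

δ* : (𝒜 : DFAO) → Fin (nStates 𝒜) → List (Bool × Bool) → Maybe (Fin (nStates 𝒜))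
δ* 𝒜 q [] = just q
δ* 𝒜 q (a ∷ w) = δ 𝒜 q a >>= λ q' → δ* 𝒜 q' w

Outputs : DFAO → List (Bool × Bool) → Fin 16 → Set
Outputs 𝒜 w k = Σ (Fin (nStates 𝒜)) λ q → (δ* 𝒜 (q₀ 𝒜) w ≡ just q) × (τ 𝒜 q ≡ k)

-- Position (n₁, n₂) gets the output of a 17-state automaton on the zipped
-- Fibonacci words of n₁ and n₂ of any large enough common length 2k + 1.
-- This does not depend on k: lengthening a word prepends its sign digit s
-- and a 0, and from the initial state the automaton reaches the same state
-- after the letters s 0 s as after s. Validity compares two runs of the
-- automaton whose first track spells n and n + 1 over a fixed second track.
-- Such pairs of Zeckendorf words are recognised by a small transducer for
-- the carry, and a finite set of states of the product of two copies of the
-- automaton with this transducer contains the initial states, is closed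
-- under every step that keeps all tracks free of the factor 11, and has
-- adjacent tiles in all its accepting states; this set is computed and
-- checked by evaluation.
module Submission where

open import Defs
open import Data.Integer using (ℤ)
open import Data.Bool using (Bool)
open import Data.List using (List)
open import Data.Product using (Σ; _×_; _,_)

open import Data.Bool using (true; false; _∧_; _∨_; if_then_else_; T)
open import Data.Bool.Properties using () renaming (_≟_ to _≟ᵇ_)
open import Data.Empty using (⊥-elim)
open import Data.Fin using (Fin; zero; suc; #_)
open import Data.Fin.Properties using () renaming (_≟_ to _≟ᶠ_)
open import Data.Integer using (+_; -[1+_]; ∣_∣) renaming (_+_ to _+ℤ_; _-_ to _-ℤ_; -_ to -ℤ_)
open import Data.Integer.Properties using (m-n≡m⊖n; ⊖-<; ∣i+j∣≤∣i∣+∣j∣)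
open import Data.List using ([]; _∷_; _++_; length; zip; zipWith; foldl; concat; concatMap; replicate)
open import Data.List.Relation.Unary.All as All using (All; all?)
open import Data.Maybe using (Maybe; just; nothing; maybe)
import Data.Maybe as Maybe
import Data.Maybe.Relation.Unary.All as MaybeAll
open import Data.Nat using (ℕ; zero; suc; _+_; _∸_; _⊔_; _≤_; _<_; _≤′_; ≤′-refl; ≤′-step; z≤n; s≤s; z<s; _≤?_; ⌊_/2⌋)
open import Data.Nat.Properties
  using ( ≤-refl; ≤-trans; <-≤-trans; <-irrefl; <⇒≤; <⇒≱; ≤⇒≤′; ≤′⇒≤; n≤1+n; m≤m+n; m≤n+m; m<m+n
        ; +-comm; +-suc; +-identityʳ; +-mono-≤; +-monoʳ-<; +-cancelˡ-≡; +-cancelˡ-≤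
        ; +-commutativeSemigroup; n≤0⇒n≡0; n>0⇒n≢0; suc-injective; ≰⇒>
        ; +-∸-assoc; m+n∸m≡n; m+n∸n≡m; m+[n∸m]≡n; m∸n+n≡m; m∸[m∸n]≡n; ∸-monoˡ-<; ∸-monoʳ-<
        ; m≤m⊔n; m≤n⊔m; mono-≤-distrib-⊔; n≡⌊n+n/2⌋; m∸n≤m )
open import Algebra.Properties.CommutativeSemigroup +-commutativeSemigroup using (interchange)
open import Data.Product using (∃; proj₁; proj₂)
open import Data.Sum using (_⊎_; inj₁; inj₂; [_,_]′)
open import Data.Unit using (tt)
open import Data.Vec using (Vec; lookup) renaming ([] to []ᵥ; _∷_ to _∷ᵥ_)
open import Function using (_∘_)
open import Relation.Binary.Definitions using (DecidableEquality)
open import Relation.Binary.PropositionalEquality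
  using (_≡_; _≢_; refl; sym; trans; cong; cong₂; subst; subst₂; module ≡-Reasoning)
open import Relation.Nullary using (¬_)
open import Relation.Nullary.Decidable using (Dec; yes; no; map′; _×-dec_; _→-dec_; T?; toWitness)

Fib-pos : ∀ n → 0 < Fib n
Fib-pos zero          = z<s
Fib-pos (suc zero)    = z<s
Fib-pos (suc (suc n)) = ≤-trans (Fib-pos (suc n)) (m≤m+n _ _)

Fib-≤-suc : ∀ n → Fib n ≤ Fib (suc n)
Fib-≤-suc zero    = ≤-refl
Fib-≤-suc (suc n) = m≤m+n _ _

Fib-<-suc-suc : ∀ n → Fib (suc n) < Fib (suc (suc n))
Fib-<-suc-suc n = m<m+n (Fib (suc n)) (Fib-pos n)

Fib-mono-≤ : ∀ {m n} → m ≤ n → Fib m ≤ Fib n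
Fib-mono-≤ = mono′ ∘ ≤⇒≤′
  where
  mono′ : ∀ {m n} → m ≤′ n → Fib m ≤ Fib n
  mono′ ≤′-refl      = ≤-refl
  mono′ {n = suc n} (≤′-step le) = ≤-trans (mono′ le) (Fib-≤-suc n)

n≤Fib[n] : ∀ n → n ≤ Fib n
n≤Fib[n] zero          = z≤n
n≤Fib[n] (suc zero)    = ≤-refl
n≤Fib[n] (suc (suc n)) =
  subst (_≤ Fib (suc n) + Fib n) (+-comm (suc n) 1) (+-mono-≤ (n≤Fib[n] (suc n)) (Fib-pos n))

-- Zeck b w: the word b w has no factor 11.
data Zeck : Bool → List Bool → Set where
  []  : ∀ {b} → Zeck b []
  0∷_ : ∀ {b w} → Zeck false w → Zeck b (false ∷ w)
  1∷_ : ∀ {w} → Zeck true w → Zeck false (true ∷ w)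

Zeck-weaken : ∀ {w} → Zeck true w → Zeck false w
Zeck-weaken []      = []
Zeck-weaken (0∷ zw) = 0∷ zw

Zeck-head : ∀ {b a w} → Zeck b (a ∷ w) → b ∧ a ≡ false
Zeck-head {false} _       = refl
Zeck-head {true}  (0∷ _)  = refl

Zeck-tail : ∀ {b a w} → Zeck b (a ∷ w) → Zeck a w
Zeck-tail (0∷ zw) = zw
Zeck-tail (1∷ zw) = zw

¬Has11⇒Zeck : ∀ b w → ¬ Has11 (b ∷ w) → Zeck b w
¬Has11⇒Zeck b     []          _  = []
¬Has11⇒Zeck b     (false ∷ w) ¬h = 0∷ ¬Has11⇒Zeck false w (¬h ∘ there b _)
¬Has11⇒Zeck false (true ∷ w)  ¬h = 1∷ ¬Has11⇒Zeck true w (¬h ∘ there false _)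
¬Has11⇒Zeck true  (true ∷ w)  ¬h = ⊥-elim (¬h (here w))

mutual
  sumF<Fib-suc-length : ∀ {w} → Zeck false w → sumF w < Fib (suc (length w))
  sumF<Fib-suc-length []                 = z<s
  sumF<Fib-suc-length {false ∷ w} (0∷ zw) =
    <-≤-trans (sumF<Fib-suc-length zw) (Fib-≤-suc (suc (length w)))
  sumF<Fib-suc-length {true ∷ w}  (1∷ zw) =
    +-monoʳ-< (Fib (suc (length w))) (sumF<Fib-length zw)

  sumF<Fib-length : ∀ {w} → Zeck true w → sumF w < Fib (length w)
  sumF<Fib-length []      = z<s
  sumF<Fib-length (0∷ zw) = sumF<Fib-suc-length zw

sumF-true≢0 : ∀ w → sumF (true ∷ w) ≢ 0
sumF-true≢0 w = n>0⇒n≢0 (≤-trans (Fib-pos (suc (length w))) (m≤m+n _ _))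

greedy : ℕ → ℕ → List Bool
greedy m zero = []
greedy m (suc k) with Fib (suc k) ≤? m
... | yes _ = true ∷ greedy (m ∸ Fib (suc k)) k
... | no  _ = false ∷ greedy m k

greedy-skip : ∀ {m k} → m < Fib (suc k) → greedy m (suc k) ≡ false ∷ greedy m k
greedy-skip {m} {k} m<F with Fib (suc k) ≤? m
... | yes F≤m = ⊥-elim (<⇒≱ m<F F≤m)
... | no  _   = refl

greedy-take : ∀ {m k} → Fib (suc k) ≤ m → greedy m (suc k) ≡ true ∷ greedy (m ∸ Fib (suc k)) k
greedy-take {m} {k} F≤m with Fib (suc k) ≤? m
... | yes _   = refl
... | no  F≰m = ⊥-elim (F≰m F≤m)

length-greedy : ∀ m k → length (greedy m k) ≡ k
length-greedy m zero = refl
length-greedy m (suc k) with Fib (suc k) ≤? m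
... | yes _ = cong suc (length-greedy (m ∸ Fib (suc k)) k)
... | no  _ = cong suc (length-greedy m k)

∸Fib<Fib : ∀ {m k} → Fib (suc k) ≤ m → m < Fib (suc (suc k)) → m ∸ Fib (suc k) < Fib k
∸Fib<Fib {m} {k} F≤m m<F = subst (m ∸ Fib (suc k) <_) (m+n∸m≡n (Fib (suc k)) (Fib k)) (∸-monoˡ-< m<F F≤m)

sumF-greedy : ∀ {m k} → m < Fib (suc k) → sumF (greedy m k) ≡ m
sumF-greedy {zero}  {zero} _ = refl
sumF-greedy {suc m} {zero} (s≤s ())
sumF-greedy {m} {suc k} m<F with Fib (suc k) ≤? m
... | no  F≰m = sumF-greedy {k = k} (≰⇒> F≰m)
... | yes F≤m = begin
  Fib (suc (length (greedy (m ∸ Fib (suc k)) k))) + sumF (greedy (m ∸ Fib (suc k)) k)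
    ≡⟨ cong₂ (λ l s → Fib (suc l) + s) (length-greedy _ k)
             (sumF-greedy {k = k} (<-≤-trans (∸Fib<Fib {k = k} F≤m m<F) (Fib-≤-suc k))) ⟩
  Fib (suc k) + (m ∸ Fib (suc k))
    ≡⟨ m+[n∸m]≡n F≤m ⟩
  m ∎
  where open ≡-Reasoning

mutual
  greedy-Zeck : ∀ {m k} → m < Fib (suc k) → Zeck false (greedy m k)
  greedy-Zeck {m} {zero} _ = []
  greedy-Zeck {m} {suc k} m<F with Fib (suc k) ≤? m
  ... | yes F≤m = 1∷ greedy-Zeck₁ {k = k} (∸Fib<Fib {k = k} F≤m m<F)
  ... | no  F≰m = 0∷ greedy-Zeck {k = k} (≰⇒> F≰m)

  greedy-Zeck₁ : ∀ {m k} → m < Fib k → Zeck true (greedy m k)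
  greedy-Zeck₁ {m} {zero} _ = []
  greedy-Zeck₁ {m} {suc k} m<F with Fib (suc k) ≤? m
  ... | yes F≤m = ⊥-elim (<⇒≱ m<F F≤m)
  ... | no  F≰m = 0∷ greedy-Zeck {k = k} (≰⇒> F≰m)

greedy-sumF : ∀ {w} → Zeck false w → greedy (sumF w) (length w) ≡ w
greedy-sumF [] = refl
greedy-sumF {false ∷ w} (0∷ zw) =
  trans (greedy-skip {k = length w} (sumF<Fib-suc-length zw)) (cong (false ∷_) (greedy-sumF zw))
greedy-sumF {true ∷ w} (1∷ zw) =
  trans (greedy-take {k = length w} (m≤m+n _ _))
        (cong (true ∷_) (trans (cong (λ m → greedy m (length w)) (m+n∸m≡n (Fib (suc (length w))) (sumF w)))
                               (greedy-sumF (Zeck-weaken zw))))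

-- Read most significant digit first, Zeckendorf words u and u′ with
-- sumF u′ = 1 + sumF u agree up to a position where u has 0 and u′ has 1,
-- after which u continues 1 0 1 0 … and u′ is all zeros. The first letter
-- is the sign digit, which differs only for the step from −1 to 0.
data Mode : Set where
  start start₋₁ agree tail10 tail00 : Mode

succStep : Mode → Bool → Bool → Maybe Mode
succStep start   false false = just agree
succStep start   true  true  = just agree
succStep start₋₁ true  false = just tail00
succStep agree   false false = just agree
succStep agree   true  true  = just agree
succStep agree   false true  = just tail10
succStep tail10  true  false = just tail00
succStep tail00  false false = just tail10
succStep _       _     _     = nothing

accepting : Mode → Bool
accepting tail10 = true
accepting tail00 = true
accepting _      = false

data Accepts : Mode → List Bool → List Bool → Set where
  []  : ∀ {m} → T (accepting m) → Accepts m [] []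
  _∷_ : ∀ {m m′ a a′ u u′} → succStep m a a′ ≡ just m′ → Accepts m′ u u′ → Accepts m (a ∷ u) (a′ ∷ u′)

-- suc (sumF u) ≡ F_{|u|+1} says that u is the largest Zeckendorf word of its length, 1 0 1 0 …
mutual
  Accepts-tail10 : ∀ {u u′} → Zeck false u → suc (sumF u) ≡ Fib (suc (length u)) →
                   sumF u′ ≡ 0 → length u ≡ length u′ → Accepts tail10 u u′
  Accepts-tail10 {[]}    {[]}         _ _ _ _  = [] tt
  Accepts-tail10 {[]}    {_ ∷ _}      _ _ _ ()
  Accepts-tail10 {_ ∷ _} {[]}         _ _ _ ()
  Accepts-tail10 {_ ∷ _} {true ∷ w′}  _ _ s′≡0 _ = ⊥-elim (sumF-true≢0 w′ s′≡0)
  Accepts-tail10 {false ∷ w} {false ∷ _} (0∷ zw) s _ _ =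
    ⊥-elim (<⇒≱ (Fib-<-suc-suc (length w)) (subst (_≤ Fib (suc (length w))) s (sumF<Fib-suc-length zw)))
  Accepts-tail10 {true ∷ w} {false ∷ _} (1∷ zw) s s′≡0 len =
    refl ∷ Accepts-tail00 zw (+-cancelˡ-≡ (Fib (suc (length w))) _ _ (trans (+-suc _ _) s))
                          s′≡0 (suc-injective len)

  Accepts-tail00 : ∀ {u u′} → Zeck true u → suc (sumF u) ≡ Fib (length u) →
                   sumF u′ ≡ 0 → length u ≡ length u′ → Accepts tail00 u u′
  Accepts-tail00 {[]}    {[]}         _ _ _ _  = [] tt
  Accepts-tail00 {[]}    {_ ∷ _}      _ _ _ ()
  Accepts-tail00 {_ ∷ _} {[]}         _ _ _ ()
  Accepts-tail00 {_ ∷ _} {true ∷ w′}  _ _ s′≡0 _ = ⊥-elim (sumF-true≢0 w′ s′≡0)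
  Accepts-tail00 {false ∷ _} {false ∷ _} (0∷ zw) s s′≡0 len =
    refl ∷ Accepts-tail10 zw s s′≡0 (suc-injective len)

Accepts-agree : ∀ {u u′} → Zeck false u → Zeck false u′ → length u ≡ length u′ →
                suc (sumF u) ≡ sumF u′ → Accepts agree u u′
Accepts-agree [] [] _ ()
Accepts-agree (0∷ zw) (0∷ zw′) len s = refl ∷ Accepts-agree zw zw′ (suc-injective len) s
Accepts-agree {true ∷ w} {true ∷ w′} (1∷ zw) (1∷ zw′) len s =
  refl ∷ Accepts-agree (Zeck-weaken zw) (Zeck-weaken zw′) (suc-injective len)
           (+-cancelˡ-≡ (Fib (suc (length w))) _ _
             (trans (+-suc _ _) (trans s (cong (λ l → Fib (suc l) + sumF w′) (sym (suc-injective len))))))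
Accepts-agree {true ∷ w} {false ∷ w′} (1∷ _) (0∷ zw′) len s =
  ⊥-elim (<-irrefl refl (<-≤-trans (sumF<Fib-suc-length zw′) F≤s′))
  where
  F≤s′ : Fib (suc (length w′)) ≤ sumF w′
  F≤s′ = subst₂ _≤_ (cong (Fib ∘ suc) (suc-injective len)) s (≤-trans (m≤m+n _ _) (n≤1+n _))
Accepts-agree {false ∷ w} {true ∷ w′} (0∷ zw) (1∷ _) len s =
  refl ∷ Accepts-tail10 zw s₁ s′≡0 (suc-injective len)
  where
  Fw : ℕ
  Fw = Fib (suc (length w))
  s≡F+s′ : suc (sumF w) ≡ Fw + sumF w′
  s≡F+s′ = trans s (cong (λ l → Fib (suc l) + sumF w′) (sym (suc-injective len)))
  s′≡0 : sumF w′ ≡ 0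
  s′≡0 = n≤0⇒n≡0 (+-cancelˡ-≤ Fw _ _
           (subst₂ _≤_ s≡F+s′ (sym (+-identityʳ Fw)) (sumF<Fib-suc-length zw)))
  s₁ : suc (sumF w) ≡ Fw
  s₁ = trans s≡F+s′ (trans (cong (λ s′ → Fw + s′) s′≡0) (+-identityʳ Fw))

double : ℕ → ℕ
double k = k + k

double-suc : ∀ k → double (suc k) ≡ suc (suc (double k))
double-suc k = cong suc (+-suc k k)

double-mono-≤ : ∀ {k k′} → k ≤ k′ → double k ≤ double k′
double-mono-≤ le = +-mono-≤ le le

-- Fits n k: n has a Fibonacci word of length 2k + 1.
data Fits : ℤ → ℕ → Set where
  fits⁺ : ∀ {m k} → m < Fib (suc (double k)) → Fits (+ m) k
  fits⁻ : ∀ {m k} → suc m ≤ Fib (double k) → Fits -[1+ m ] k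

sign : ℤ → Bool
sign (+ _)    = false
sign -[1+ _ ] = true

-- val_F (1 w) = sumF w − F_{|w|}, so −(m + 1) is written 1 w with
-- sumF w = F_{2k} − (m + 1).
digits : ℤ → ℕ → List Bool
digits (+ m)    k = greedy m (double k)
digits -[1+ m ] k = greedy (Fib (double k) ∸ suc m) (double k)

word : ℤ → ℕ → List Bool
word n k = sign n ∷ digits n k

length-digits : ∀ n k → length (digits n k) ≡ double k
length-digits (+ m)    k = length-greedy m (double k)
length-digits -[1+ m ] k = length-greedy _ (double k)

∸-suc-< : ∀ {m n} → suc m ≤ n → n ∸ suc m < n
∸-suc-< = ∸-monoʳ-< z<s

digits-Zeck : ∀ {n k} → Fits n k → Zeck (sign n) (digits n k)
digits-Zeck {k = k} (fits⁺ m<F) = greedy-Zeck {k = double k} m<F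
digits-Zeck {k = k} (fits⁻ m<F) = greedy-Zeck₁ {k = double k} (∸-suc-< m<F)

word-Zeck : ∀ {n k} → Fits n k → Zeck false (word n k)
word-Zeck f@(fits⁺ _) = 0∷ digits-Zeck f
word-Zeck f@(fits⁻ _) = 1∷ digits-Zeck f

Fits-mono : ∀ {n k k′} → k ≤ k′ → Fits n k → Fits n k′
Fits-mono le (fits⁺ m<F) = fits⁺ (<-≤-trans m<F (Fib-mono-≤ (s≤s (double-mono-≤ le))))
Fits-mono le (fits⁻ m<F) = fits⁻ (≤-trans m<F (Fib-mono-≤ (double-mono-≤ le)))

∣∣≤⇒Fits : ∀ n {k} → ∣ n ∣ ≤ k → Fits n k
∣∣≤⇒Fits (+ m)    {k} le = fits⁺ (<-≤-trans (s≤s (≤-trans le (m≤m+n k k))) (n≤Fib[n] (suc (double k))))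
∣∣≤⇒Fits -[1+ m ] {k} le = fits⁻ (≤-trans (≤-trans le (m≤m+n k k)) (n≤Fib[n] (double k)))

digits-suc : ∀ {n k} → Fits n k → digits n (suc k) ≡ false ∷ word n k
digits-suc {+ m} {k} (fits⁺ m<F) = begin
  greedy m (double (suc k))           ≡⟨ cong (greedy m) (double-suc k) ⟩
  greedy m (suc (suc (double k)))     ≡⟨ greedy-skip (<-≤-trans m<F (Fib-≤-suc (suc (double k)))) ⟩
  false ∷ greedy m (suc (double k))   ≡⟨ cong (false ∷_) (greedy-skip {k = double k} m<F) ⟩
  false ∷ false ∷ greedy m (double k) ∎
  where open ≡-Reasoning
digits-suc { -[1+ m ]} {k} (fits⁻ m<F) = begin
  greedy (Fib (double (suc k)) ∸ suc m) (double (suc k))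
    ≡⟨ cong (λ d → greedy (Fib d ∸ suc m) d) (double-suc k) ⟩
  greedy (Fib (suc (suc d)) ∸ suc m) (suc (suc d))
    ≡⟨ greedy-skip {k = suc d} (∸-suc-< (≤-trans m<F (Fib-mono-≤ (m≤n+m d 2)))) ⟩
  false ∷ greedy (Fib (suc d) + Fib d ∸ suc m) (suc d)
    ≡⟨ cong (λ v → false ∷ greedy v (suc d)) (+-∸-assoc (Fib (suc d)) m<F) ⟩
  false ∷ greedy (Fib (suc d) + (Fib d ∸ suc m)) (suc d)
    ≡⟨ cong (false ∷_) (greedy-take {k = d} (m≤m+n _ _)) ⟩
  false ∷ true ∷ greedy (Fib (suc d) + (Fib d ∸ suc m) ∸ Fib (suc d)) d
    ≡⟨ cong (λ v → false ∷ true ∷ greedy v d) (m+n∸m≡n (Fib (suc d)) _) ⟩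
  false ∷ true ∷ greedy (Fib d ∸ suc m) d ∎
  where
  open ≡-Reasoning
  d : ℕ
  d = double k

word-suc : ∀ {n k} → Fits n k → word n (suc k) ≡ sign n ∷ false ∷ word n k
word-suc f = cong (_ ∷_) (digits-suc f)

suc[m∸suc[n]]≡m∸n : ∀ {m n} → suc n ≤ m → suc (m ∸ suc n) ≡ m ∸ n
suc[m∸suc[n]]≡m∸n {suc m} (s≤s n≤m) = sym (+-∸-assoc 1 n≤m)

word-succ : ∀ {n k} → Fits n k → Fits (n +ℤ + 1) k →
            Accepts start (word n k) (word (n +ℤ + 1) k) ⊎ Accepts start₋₁ (word n k) (word (n +ℤ + 1) k)
word-succ {+ m} {k} f@(fits⁺ m<F) f′@(fits⁺ m+1<F) =
  inj₁ (refl ∷ Accepts-agree (digits-Zeck f) (digits-Zeck f′)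
                 (trans (length-greedy m d) (sym (length-greedy (m + 1) d)))
                 (trans (cong suc (sumF-greedy {k = d} m<F))
                        (trans (+-comm 1 m) (sym (sumF-greedy {k = d} m+1<F)))))
  where
  d : ℕ
  d = double k
word-succ { -[1+ zero ]} {k} f@(fits⁻ 1≤F) _ =
  inj₂ (refl ∷ Accepts-tail00 (digits-Zeck f)
                 (trans (cong suc (sumF-greedy {k = d} (<-≤-trans (∸-suc-< 1≤F) (Fib-≤-suc d))))
                        (trans (sym (+-∸-assoc 1 1≤F)) (cong Fib (sym (length-greedy _ d)))))
                 (sumF-greedy {k = d} (Fib-pos (suc d)))
                 (trans (length-greedy _ d) (sym (length-greedy 0 d))))
  where
  d : ℕ
  d = double k
word-succ { -[1+ suc m ]} {k} f@(fits⁻ m+2≤F) f′@(fits⁻ m+1≤F) =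
  inj₁ (refl ∷ Accepts-agree (Zeck-weaken (digits-Zeck f))
                             (Zeck-weaken (digits-Zeck f′))
                 (trans (length-greedy _ d) (sym (length-greedy _ d)))
                 (trans (cong suc (sumF-greedy {k = d} (<-≤-trans (∸-suc-< m+2≤F) (Fib-≤-suc d))))
                        (trans (suc[m∸suc[n]]≡m∸n m+2≤F)
                               (sym (sumF-greedy {k = d} (<-≤-trans (∸-suc-< m+1≤F) (Fib-≤-suc d)))))))
  where
  d : ℕ
  d = double k

-- State 0 is initial; state 1 + i outputs tile i.
State : Set
State = Fin 17

-- the successors of each state on the letters 00, 01, 10, 11 (top digit first)
transitions : Vec (Vec State 4) 17
transitions =
  (# 13 ∷ᵥ # 7 ∷ᵥ # 9  ∷ᵥ # 2  ∷ᵥ []ᵥ) ∷ᵥ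
  (# 15 ∷ᵥ # 1 ∷ᵥ # 1  ∷ᵥ # 1  ∷ᵥ []ᵥ) ∷ᵥ
  (# 14 ∷ᵥ # 2 ∷ᵥ # 2  ∷ᵥ # 2  ∷ᵥ []ᵥ) ∷ᵥ
  (# 13 ∷ᵥ # 3 ∷ᵥ # 11 ∷ᵥ # 3  ∷ᵥ []ᵥ) ∷ᵥ
  (# 12 ∷ᵥ # 4 ∷ᵥ # 9  ∷ᵥ # 4  ∷ᵥ []ᵥ) ∷ᵥ
  (# 15 ∷ᵥ # 5 ∷ᵥ # 8  ∷ᵥ # 5  ∷ᵥ []ᵥ) ∷ᵥ
  (# 14 ∷ᵥ # 6 ∷ᵥ # 8  ∷ᵥ # 6  ∷ᵥ []ᵥ) ∷ᵥ
  (# 13 ∷ᵥ # 7 ∷ᵥ # 8  ∷ᵥ # 7  ∷ᵥ []ᵥ) ∷ᵥ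
  (# 13 ∷ᵥ # 7 ∷ᵥ # 8  ∷ᵥ # 8  ∷ᵥ []ᵥ) ∷ᵥ
  (# 15 ∷ᵥ # 4 ∷ᵥ # 9  ∷ᵥ # 9  ∷ᵥ []ᵥ) ∷ᵥ
  (# 14 ∷ᵥ # 4 ∷ᵥ # 10 ∷ᵥ # 10 ∷ᵥ []ᵥ) ∷ᵥ
  (# 13 ∷ᵥ # 3 ∷ᵥ # 11 ∷ᵥ # 11 ∷ᵥ []ᵥ) ∷ᵥ
  (# 13 ∷ᵥ # 7 ∷ᵥ # 11 ∷ᵥ # 2  ∷ᵥ []ᵥ) ∷ᵥ
  (# 12 ∷ᵥ # 7 ∷ᵥ # 9  ∷ᵥ # 2  ∷ᵥ []ᵥ) ∷ᵥ
  (# 16 ∷ᵥ # 6 ∷ᵥ # 10 ∷ᵥ # 2  ∷ᵥ []ᵥ) ∷ᵥ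
  (# 12 ∷ᵥ # 5 ∷ᵥ # 9  ∷ᵥ # 2  ∷ᵥ []ᵥ) ∷ᵥ
  (# 13 ∷ᵥ # 3 ∷ᵥ # 8  ∷ᵥ # 1  ∷ᵥ []ᵥ) ∷ᵥ []ᵥ

letterIndex : Bool × Bool → Fin 4
letterIndex (false , false) = # 0
letterIndex (false , true)  = # 1
letterIndex (true  , false) = # 2
letterIndex (true  , true)  = # 3

step : State → Bool × Bool → State
step q ab = lookup (lookup transitions q) (letterIndex ab)

output : State → Fin 16
output zero    = zero
output (suc i) = i

𝒜 : DFAO
𝒜 = record { nStates = 17 ; δ = λ q ab → just (step q ab) ; q₀ = zero ; τ = output }

δ*≡foldl : ∀ q w → δ* 𝒜 q w ≡ just (foldl step q w)
δ*≡foldl q []       = refl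
δ*≡foldl q (ab ∷ w) = δ*≡foldl (step q ab) w

padding-invisible : ∀ ab → step (step (step zero ab) (false , false)) ab ≡ step zero ab
padding-invisible (false , false) = refl
padding-invisible (false , true)  = refl
padding-invisible (true  , false) = refl
padding-invisible (true  , true)  = refl

readout : ℤ × ℤ → ℕ → State
readout (n₁ , n₂) k = foldl step zero (zip (word n₁ k) (word n₂ k))

readout-suc : ∀ {n₁ n₂ k} → Fits n₁ k → Fits n₂ k → readout (n₁ , n₂) (suc k) ≡ readout (n₁ , n₂) k
readout-suc {n₁} {n₂} {k} f₁ f₂ = begin
  foldl step (step zero s) (zip (digits n₁ (suc k)) (digits n₂ (suc k)))
    ≡⟨ cong₂ (λ u v → foldl step (step zero s) (zip u v)) (digits-suc f₁) (digits-suc f₂) ⟩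
  foldl step (step (step (step zero s) (false , false)) s) (zip (digits n₁ k) (digits n₂ k))
    ≡⟨ cong (λ q → foldl step q (zip (digits n₁ k) (digits n₂ k))) (padding-invisible s) ⟩
  foldl step (step zero s) (zip (digits n₁ k) (digits n₂ k)) ∎
  where
  open ≡-Reasoning
  s : Bool × Bool
  s = sign n₁ , sign n₂

readout-stable : ∀ {n₁ n₂ k k′} → k ≤ k′ → Fits n₁ k → Fits n₂ k → readout (n₁ , n₂) k′ ≡ readout (n₁ , n₂) k
readout-stable {n₁} {n₂} {k} k≤k′ f₁ f₂ = stable′ (≤⇒≤′ k≤k′)
  where
  stable′ : ∀ {k′} → k ≤′ k′ → readout (n₁ , n₂) k′ ≡ readout (n₁ , n₂) k
  stable′ ≤′-refl      = refl
  stable′ (≤′-step le) =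
    trans (readout-suc (Fits-mono (≤′⇒≤ le) f₁) (Fits-mono (≤′⇒≤ le) f₂)) (stable′ le)

tiling : Configuration
tiling (n₁ , n₂) = output (readout (n₁ , n₂) (∣ n₁ ∣ ⊔ ∣ n₂ ∣))

tiling-readout : ∀ {n₁ n₂ k} → Fits n₁ k → Fits n₂ k → tiling (n₁ , n₂) ≡ output (readout (n₁ , n₂) k)
tiling-readout {n₁} {n₂} {k} f₁ f₂ = cong output (trans
  (sym (readout-stable (m≤m⊔n k₀ k) (∣∣≤⇒Fits n₁ (m≤m⊔n _ _)) (∣∣≤⇒Fits n₂ (m≤n⊔m _ _))))
  (readout-stable (m≤n⊔m k₀ k) f₁ f₂))
  where
  k₀ : ℕ
  k₀ = ∣ n₁ ∣ ⊔ ∣ n₂ ∣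

data Axis : Set where
  horizontal vertical : Axis

Adjacent : Axis → Tile → Tile → Set
Adjacent horizontal t t′ = east t ≡ west t′
Adjacent vertical   t t′ = north t ≡ south t′

colorIndex : Color → Fin 16
colorIndex A = # 0
colorIndex B = # 1
colorIndex C = # 2
colorIndex D = # 3
colorIndex E = # 4
colorIndex F = # 5
colorIndex G = # 6
colorIndex H = # 7
colorIndex I = # 8
colorIndex J = # 9
colorIndex K = # 10
colorIndex L = # 11
colorIndex M = # 12
colorIndex N = # 13
colorIndex O = # 14
colorIndex P = # 15

colorAt : Fin 16 → Color
colorAt i = lookup (A ∷ᵥ B ∷ᵥ C ∷ᵥ D ∷ᵥ E ∷ᵥ F ∷ᵥ G ∷ᵥ H ∷ᵥ I ∷ᵥ J ∷ᵥ K ∷ᵥ L ∷ᵥ M ∷ᵥ N ∷ᵥ O ∷ᵥ P ∷ᵥ []ᵥ) i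

colorAt-colorIndex : ∀ c → colorAt (colorIndex c) ≡ c
colorAt-colorIndex A = refl
colorAt-colorIndex B = refl
colorAt-colorIndex C = refl
colorAt-colorIndex D = refl
colorAt-colorIndex E = refl
colorAt-colorIndex F = refl
colorAt-colorIndex G = refl
colorAt-colorIndex H = refl
colorAt-colorIndex I = refl
colorAt-colorIndex J = refl
colorAt-colorIndex K = refl
colorAt-colorIndex L = refl
colorAt-colorIndex M = refl
colorAt-colorIndex N = refl
colorAt-colorIndex O = refl
colorAt-colorIndex P = refl

_≟ᶜ_ : DecidableEquality Color
c ≟ᶜ c′ = map′ (λ eq → trans (sym (colorAt-colorIndex c)) (trans (cong colorAt eq) (colorAt-colorIndex c′)))
               (cong colorIndex) (colorIndex c ≟ᶠ colorIndex c′)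

adjacent? : ∀ ax t t′ → Dec (Adjacent ax t t′)
adjacent? horizontal t t′ = east t ≟ᶜ west t′
adjacent? vertical   t t′ = north t ≟ᶜ south t′

modeIndex : Mode → Fin 5
modeIndex start   = # 0
modeIndex start₋₁ = # 1
modeIndex agree   = # 2
modeIndex tail10  = # 3
modeIndex tail00  = # 4

modeAt : Fin 5 → Mode
modeAt i = lookup (start ∷ᵥ start₋₁ ∷ᵥ agree ∷ᵥ tail10 ∷ᵥ tail00 ∷ᵥ []ᵥ) i

modeAt-modeIndex : ∀ m → modeAt (modeIndex m) ≡ m
modeAt-modeIndex start   = refl
modeAt-modeIndex start₋₁ = refl
modeAt-modeIndex agree   = refl
modeAt-modeIndex tail10  = refl
modeAt-modeIndex tail00  = refl

_≟ᵐ_ : DecidableEquality Mode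
m ≟ᵐ m′ = map′ (λ eq → trans (sym (modeAt-modeIndex m)) (trans (cong modeAt eq) (modeAt-modeIndex m′)))
               (cong modeIndex) (modeIndex m ≟ᶠ modeIndex m′)

-- Along an axis, the first track carries n resp. n + 1 and the second the other coordinate.
letter : Axis → Bool → Bool → Bool × Bool
letter horizontal a b = a , b
letter vertical   a b = b , a

-- the runs of 𝒜 on (u, v) and (u′, v), the transducer on (u, u′), and the last digits of u, u′, v
record Joint : Set where
  constructor joint
  field
    state state′    : State
    mode            : Mode
    last last′ lastᵥ : Bool
open Joint

_≟ʲ_ : DecidableEquality Joint
joint s t m a b c ≟ʲ joint s′ t′ m′ a′ b′ c′ =
  map′ (λ { (refl , refl , refl , refl , refl , refl) → refl })
       (λ { refl → refl , refl , refl , refl , refl , refl })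
       (s ≟ᶠ s′ ×-dec t ≟ᶠ t′ ×-dec m ≟ᵐ m′ ×-dec a ≟ᵇ a′ ×-dec b ≟ᵇ b′ ×-dec c ≟ᵇ c′)

open import Data.List.Membership.DecPropositional _≟ʲ_ using (_∈_; _∈?_)

advance : Axis → Joint → Bool → Bool → Bool → Mode → Joint
advance ax (joint s s′ _ _ _ _) a a′ b m′ = joint (step s (letter ax a b)) (step s′ (letter ax a′ b)) m′ a a′ b

next : Axis → Joint → Bool → Bool → Bool → Maybe Joint
next ax c a a′ b =
  if last c ∧ a ∨ last′ c ∧ a′ ∨ lastᵥ c ∧ b then nothing
  else Maybe.map (advance ax c a a′ b) (succStep (mode c) a a′)

next-just : ∀ ax {c a a′ b m′} → last c ∧ a ≡ false → last′ c ∧ a′ ≡ false → lastᵥ c ∧ b ≡ false →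
            succStep (mode c) a a′ ≡ just m′ → next ax c a a′ b ≡ just (advance ax c a a′ b m′)
next-just ax e e′ eᵥ eₘ rewrite e | e′ | eᵥ | eₘ = refl

initial : Mode → Joint
initial m = joint zero zero m false false false

bits : List Bool
bits = false ∷ true ∷ []

successors : Axis → Joint → List Joint
successors ax c =
  concatMap (λ a → concatMap (λ a′ → concatMap (λ b → maybe (_∷ []) [] (next ax c a a′ b)) bits) bits) bits

explore : Axis → ℕ → List Joint → List Joint → List Joint
explore ax zero       seen _          = seen
explore ax (suc fuel) seen []         = seen
explore ax (suc fuel) seen (c ∷ todo) with c ∈? seen
... | yes _ = explore ax fuel seen todo
... | no  _ = explore ax fuel (c ∷ seen) (todo ++ successors ax c)

-- a breadth-first search with enough fuel; only its closedness matters
reachable : Axis → List Joint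
reachable ax = explore ax 1000 [] (initial start ∷ initial start₋₁ ∷ [])

tileOf : State → Tile
tileOf q = z (output q)

Invariant : Axis → List Joint → Joint → Set
Invariant ax R c =
  (∀ a a′ b → MaybeAll.All (_∈ R) (next ax c a a′ b))
  × (T (accepting (mode c)) → Adjacent ax (tileOf (state c)) (tileOf (state′ c)))

∀-Bool? : ∀ {Q : Bool → Set} → (∀ b → Dec (Q b)) → Dec (∀ b → Q b)
∀-Bool? Q? = map′ (λ { (qf , qt) false → qf ; (qf , qt) true → qt }) (λ q → q false , q true)
                  (Q? false ×-dec Q? true)

invariant? : ∀ ax R c → Dec (Invariant ax R c)
invariant? ax R c =
  ∀-Bool? (λ a → ∀-Bool? λ a′ → ∀-Bool? λ b → MaybeAll.dec (_∈? R) (next ax c a a′ b))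
  ×-dec (T? _ →-dec adjacent? ax _ _)

Certified : Axis → Set
Certified ax = All (Invariant ax R) R × initial start ∈ R × initial start₋₁ ∈ R
  where
  R : List Joint
  R = reachable ax

certified? : ∀ ax → Dec (Certified ax)
certified? ax = all? (invariant? ax R) R ×-dec initial start ∈? R ×-dec initial start₋₁ ∈? R
  where
  R : List Joint
  R = reachable ax

certificate : ∀ ax → Certified ax
certificate horizontal = toWitness {a? = certified? horizontal} tt
certificate vertical   = toWitness {a? = certified? vertical} tt

invariant-sound : ∀ {ax R} → All (Invariant ax R) R → ∀ {c u u′ v} → c ∈ R →
  Zeck (last c) u → Zeck (last′ c) u′ → Zeck (lastᵥ c) v → length u ≡ length v → Accepts (mode c) u u′ →
  Adjacent ax (tileOf (foldl step (state c) (zipWith (letter ax) u v)))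
              (tileOf (foldl step (state′ c) (zipWith (letter ax) u′ v)))
invariant-sound inv c∈R _ _ _ _ ([] acc) = proj₂ (All.lookup inv c∈R) acc
invariant-sound {ax} {R} inv {c} {a ∷ _} {a′ ∷ _} {b ∷ _} c∈R zu zu′ zv len (_∷_ {m′ = m′} m→m′ acc) =
  invariant-sound inv next∈R (Zeck-tail zu) (Zeck-tail zu′) (Zeck-tail zv) (suc-injective len) acc
  where
  next∈R : advance ax c a a′ b m′ ∈ R
  next∈R = MaybeAll.drop-just (subst (MaybeAll.All (_∈ R))
             (next-just ax {c} (Zeck-head zu) (Zeck-head zu′) (Zeck-head zv) m→m′)
             (proj₁ (All.lookup inv c∈R) a a′ b))

place : Axis → ℤ → ℤ → ℤ × ℤ
place horizontal n m = n , m
place vertical   n m = m , n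

zipWith-letter-vertical : ∀ u v → zipWith (letter vertical) u v ≡ zip v u
zipWith-letter-vertical []      []      = refl
zipWith-letter-vertical []      (_ ∷ _) = refl
zipWith-letter-vertical (_ ∷ _) []      = refl
zipWith-letter-vertical (a ∷ u) (b ∷ v) = cong (_ ∷_) (zipWith-letter-vertical u v)

tiling-place : ∀ ax {n m k} → Fits n k → Fits m k →
               tiling (place ax n m) ≡ output (foldl step zero (zipWith (letter ax) (word n k) (word m k)))
tiling-place horizontal fn fm = tiling-readout fn fm
tiling-place vertical {n} {m} {k} fn fm =
  trans (tiling-readout fm fn)
        (cong (output ∘ foldl step zero) (sym (zipWith-letter-vertical (word n k) (word m k))))

∣n+1∣≤1+∣n∣ : ∀ n → ∣ n +ℤ + 1 ∣ ≤ suc ∣ n ∣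
∣n+1∣≤1+∣n∣ n = subst (∣ n +ℤ + 1 ∣ ≤_) (+-comm ∣ n ∣ 1) (∣i+j∣≤∣i∣+∣j∣ n (+ 1))

tiling-adjacent : ∀ ax n m → Adjacent ax (z (tiling (place ax n m))) (z (tiling (place ax (n +ℤ + 1) m)))
tiling-adjacent ax n m =
  subst₂ (Adjacent ax) (cong z (sym (tiling-place ax fn fm))) (cong z (sym (tiling-place ax fn′ fm)))
    ([ adjacent-from (proj₁ (proj₂ cert)) , adjacent-from (proj₂ (proj₂ cert)) ]′ (word-succ fn fn′))
  where
  k : ℕ
  k = suc (∣ n ∣ ⊔ ∣ m ∣)
  fn : Fits n k
  fn = ∣∣≤⇒Fits n (≤-trans (m≤m⊔n ∣ n ∣ ∣ m ∣) (n≤1+n _))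
  fn′ : Fits (n +ℤ + 1) k
  fn′ = ∣∣≤⇒Fits (n +ℤ + 1) (≤-trans (∣n+1∣≤1+∣n∣ n) (s≤s (m≤m⊔n ∣ n ∣ ∣ m ∣)))
  fm : Fits m k
  fm = ∣∣≤⇒Fits m (≤-trans (m≤n⊔m ∣ n ∣ ∣ m ∣) (n≤1+n _))
  cert : Certified ax
  cert = certificate ax
  adjacent-from : ∀ {md} → initial md ∈ reachable ax → Accepts md (word n k) (word (n +ℤ + 1) k) →
                  Adjacent ax (tileOf (foldl step zero (zipWith (letter ax) (word n k) (word m k))))
                              (tileOf (foldl step zero (zipWith (letter ax) (word (n +ℤ + 1) k) (word m k))))
  adjacent-from i∈R = invariant-sound (proj₁ cert) i∈R (word-Zeck fn) (word-Zeck fn′) (word-Zeck fm)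
               (cong suc (trans (length-digits n k) (sym (length-digits m k))))

tiling-valid : Valid tiling
tiling-valid n₁ n₂ = tiling-adjacent horizontal n₁ n₂ , tiling-adjacent vertical n₂ n₁

OddLength⇒length : ∀ {u} → OddLength u → ∃ λ j → length u ≡ suc (double j)
OddLength⇒length (one _) = 0 , refl
OddLength⇒length (two _ _ _ odd) with OddLength⇒length odd
... | j , len = suc j , cong (λ l → suc (suc l)) (trans len (sym (suc-injective (double-suc j))))

+m-+n≡-[1+n∸suc[m]] : ∀ {m n} → m < n → + m -ℤ + n ≡ -[1+ (n ∸ suc m) ]
+m-+n≡-[1+n∸suc[m]] {m} {suc n} (s≤s m≤n) =
  trans (m-n≡m⊖n m (suc n)) (trans (⊖-< (s≤s m≤n)) (cong (-ℤ_ ∘ +_) (+-∸-assoc 1 m≤n)))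

word-valF : ∀ b {w j} → Zeck b w → length w ≡ double j → Fits (valF (b ∷ w)) j × b ∷ w ≡ word (valF (b ∷ w)) j
word-valF false {w} {j} zw len =
  subst (λ n → Fits n j × false ∷ w ≡ word n j) (cong +_ (sym (+-identityʳ (sumF w))))
    ( fits⁺ (subst (λ l → sumF w < Fib (suc l)) len (sumF<Fib-suc-length zw))
    , cong (false ∷_) (sym (trans (cong (greedy (sumF w)) (sym len)) (greedy-sumF zw))))
word-valF true {w} {j} zw len =
  subst (λ n → Fits n j × true ∷ w ≡ word n j)
        (sym (trans (cong (λ l → + s -ℤ + Fib l) len) (+m-+n≡-[1+n∸suc[m]] s<F)))
    ( fits⁻ (subst (_≤ Fib (double j)) (sym (suc[m∸suc[n]]≡m∸n s<F)) (m∸n≤m _ s))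
    , cong (true ∷_) (sym (begin
        greedy (Fib (double j) ∸ suc (Fib (double j) ∸ suc s)) (double j)
          ≡⟨ cong (λ x → greedy (Fib (double j) ∸ x) (double j)) (suc[m∸suc[n]]≡m∸n s<F) ⟩
        greedy (Fib (double j) ∸ (Fib (double j) ∸ s)) (double j)
          ≡⟨ cong₂ greedy (m∸[m∸n]≡n (<⇒≤ s<F)) (sym len) ⟩
        greedy s (length w)
          ≡⟨ greedy-sumF (Zeck-weaken zw) ⟩
        w ∎)))
  where
  open ≡-Reasoning
  s : ℕ
  s = sumF w
  s<F : s < Fib (double j)
  s<F = subst (λ l → s < Fib l) len (sumF<Fib-length zw)

IsRepF⇒word : ∀ {u n} → IsRepF u n → ∃ λ j → Fits n j × u ≡ word n j
IsRepF⇒word {b ∷ w} (odd , ¬11 , _ , _ , refl) with OddLength⇒length odd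
... | j , len = j , word-valF b (¬Has11⇒Zeck b w ¬11) (suc-injective len)

replicate-pad : ∀ {n j} d → Fits n j → concat (replicate d (sign n ∷ false ∷ [])) ++ word n j ≡ word n (d + j)
replicate-pad zero f = refl
replicate-pad {n} {j} (suc d) f =
  trans (cong (λ w → sign n ∷ false ∷ w) (replicate-pad d f)) (sym (word-suc (Fits-mono (m≤n+m j d) f)))

pad-word+ : ∀ {n j} d → Fits n j → pad (suc (double (d + j))) (word n j) ≡ word n (d + j)
pad-word+ {n} {j} d f =
  trans (cong (λ h → concat (replicate h (sign n ∷ false ∷ [])) ++ word n j) half) (replicate-pad d f)
  where
  open ≡-Reasoning
  half : ⌊ (double (d + j) ∸ length (digits n j)) /2⌋ ≡ d
  half = begin
    ⌊ (double (d + j) ∸ length (digits n j)) /2⌋ ≡⟨ cong (λ l → ⌊ (double (d + j) ∸ l) /2⌋) (length-digits n j) ⟩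
    ⌊ (double (d + j) ∸ double j) /2⌋            ≡⟨ cong (λ x → ⌊ (x ∸ double j) /2⌋) (interchange d j d j) ⟩
    ⌊ (double d + double j ∸ double j) /2⌋       ≡⟨ cong ⌊_/2⌋ (m+n∸n≡m (double d) (double j)) ⟩
    ⌊ double d /2⌋                               ≡⟨ sym (n≡⌊n+n/2⌋ d) ⟩
    d                                            ∎

pad-word : ∀ {n j j′} → j ≤ j′ → Fits n j → pad (suc (double j′)) (word n j) ≡ word n j′
pad-word {n} {j} {j′} j≤j′ f =
  subst (λ j′ → pad (suc (double j′)) (word n j) ≡ word n j′) (m∸n+n≡m j≤j′) (pad-word+ (j′ ∸ j) f)

pairRep-word : ∀ {n₁ n₂ j₁ j₂} → Fits n₁ j₁ → Fits n₂ j₂ →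
               pairRep (word n₁ j₁) (word n₂ j₂) ≡ zip (word n₁ (j₁ ⊔ j₂)) (word n₂ (j₁ ⊔ j₂))
pairRep-word {n₁} {n₂} {j₁} {j₂} f₁ f₂ =
  trans (cong (λ t → zip (pad t (word n₁ j₁)) (pad t (word n₂ j₂))) t≡)
        (cong₂ zip (pad-word (m≤m⊔n j₁ j₂) f₁) (pad-word (m≤n⊔m j₁ j₂) f₂))
  where
  t≡ : length (word n₁ j₁) ⊔ length (word n₂ j₂) ≡ suc (double (j₁ ⊔ j₂))
  t≡ = trans (cong₂ (λ l₁ l₂ → suc l₁ ⊔ suc l₂) (length-digits n₁ j₁) (length-digits n₂ j₂))
             (sym (mono-≤-distrib-⊔ {f = λ j → suc (double j)} (λ le → s≤s (double-mono-≤ le)) j₁ j₂))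

𝒜-reads-tiling : ∀ {n₁ n₂ u v} → IsRepF u n₁ → IsRepF v n₂ → Outputs 𝒜 (pairRep u v) (tiling (n₁ , n₂))
𝒜-reads-tiling {n₁} {n₂} r₁ r₂ with IsRepF⇒word r₁ | IsRepF⇒word r₂
... | j₁ , f₁ , refl | j₂ , f₂ , refl =
  _ , trans (δ*≡foldl zero (pairRep (word n₁ j₁) (word n₂ j₂))) (cong (just ∘ foldl step zero) (pairRep-word f₁ f₂))
    , sym (tiling-readout (Fits-mono (m≤m⊔n j₁ j₂) f₁) (Fits-mono (m≤n⊔m j₁ j₂) f₂))

theorem1 : Σ Configuration λ x → Valid x × Σ DFAO λ 𝒜 →
    ∀ (n₁ n₂ : ℤ) (u v : List Bool) → IsRepF u n₁ → IsRepF v n₂ →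
      Outputs 𝒜 (pairRep u v) (x (n₁ , n₂))
theorem1 = tiling , tiling-valid , 𝒜 , λ _ _ _ _ → 𝒜-reads-tiling
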